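{- Let $\Gamma$ be a finite connected $(G,s)$-geodesic-transitive digraph for some integer $s\geq 1$, where $G\leq\mathrm{Aut}(\Gamma)$, and let $N$ be a nontrivial normal subgroup of $G$ that is intransitive on $V(\Gamma)$. Then no $N$-orbit contains an arc of $\Gamma$ (i.e. there is no arc $(u,v)$ with $u,v$ in the same $N$-orbit).
   Context: A digraph $\Gamma$ consists of a finite vertex set $V(\Gamma)$ with an antisymmetric irreflexive relation $\rightarrow$; an arc is an ordered pair $(u,v)$ with $u\rightarrow v$. Connected means the underlying undirected graph is connected. The distance $d_\Gamma(u,v)$ is the length of a shortest directed path from $u$ to $v$. An $s$-arc is a sequence $(v_0,\dots,v_s)$ with $v_i\rightarrow v_{i+1}$ for all $i$; it is an $s$-geodesic if $d_\Gamma(v_0,v_s)=s$. $\Gamma$ is $(G,s)$-geodesic-transitive if $G$ is transitive on the set of $i$-geodesics for each $i\leq s$. -}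

module Defs where

open import Data.Nat using (ℕ; suc; _≤_; _<_)
open import Data.Fin using (Fin)
open import Data.Fin.Permutation using (Permutation′; _⟨$⟩ʳ_; _≈_; id; flip; _∘ₚ_)
open import Data.Vec using (Vec; []; _∷_; head; last; map)
open import Data.Product using (Σ; ∃; _×_; _,_)
open import Data.Sum using (_⊎_)
open import Data.Empty using (⊥)
open import Data.Unit using (⊤)
open import Relation.Nullary using (¬_)
open import Relation.Binary.PropositionalEquality using (_≡_; _≢_)
open import Relation.Binary.Construct.Closure.ReflexiveTransitive using (Star)

record Digraph (n : ℕ) : Set₁ where
  field
    _⇒_     : Fin n → Fin n → Set
    irrefl  : ∀ {u} → ¬ (u ⇒ u)
    antisym : ∀ {u v} → u ⇒ v → ¬ (v ⇒ u)
open Digraph public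

Connected : ∀ {n} → Digraph n → Set
Connected {n} Γ = ∀ (u v : Fin n) → Star (λ a b → (_⇒_ Γ a b) ⊎ (_⇒_ Γ b a)) u v

IsArcSeq : ∀ {n} → Digraph n → ∀ {s} → Vec (Fin n) (suc s) → Set
IsArcSeq Γ (v ∷ []) = ⊤
IsArcSeq Γ (v ∷ w ∷ vs) = (_⇒_ Γ v w) × IsArcSeq Γ (w ∷ vs)

Dist : ∀ {n} → Digraph n → Fin n → Fin n → ℕ → Set
Dist {n} Γ u v s =
  (Σ (Vec (Fin n) (suc s)) λ p → IsArcSeq Γ p × head p ≡ u × last p ≡ v)
  × (∀ j → j < s → ¬ (Σ (Vec (Fin n) (suc j)) λ p → IsArcSeq Γ p × head p ≡ u × last p ≡ v))

IsGeodesic : ∀ {n} → Digraph n → ∀ {s} → Vec (Fin n) (suc s) → Set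
IsGeodesic Γ {s} p = IsArcSeq Γ p × Dist Γ (head p) (last p) s

IsAut : ∀ {n} → Digraph n → Permutation′ n → Set
IsAut Γ g = ∀ u v → ((_⇒_ Γ u v → _⇒_ Γ (g ⟨$⟩ʳ u) (g ⟨$⟩ʳ v))
                   × (_⇒_ Γ (g ⟨$⟩ʳ u) (g ⟨$⟩ʳ v) → _⇒_ Γ u v))

record IsSubgroup {n : ℕ} (H : Permutation′ n → Set) : Set where
  field
    resp    : ∀ {g h} → g ≈ h → H g → H h
    id-mem  : H id
    ∘-mem   : ∀ {g h} → H g → H h → H (g ∘ₚ h)
    inv-mem : ∀ {g} → H g → H (flip g)

record IsNormalSubgroupOf {n : ℕ} (N G : Permutation′ n → Set) : Set where
  field
    subgroup : IsSubgroup N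
    N⊆G      : ∀ {g} → N g → G g
    conj     : ∀ {g x} → G g → N x → N ((flip g ∘ₚ x) ∘ₚ g)

GeodesicTransitive : ∀ {n} → Digraph n → (Permutation′ n → Set) → ℕ → Set
GeodesicTransitive {n} Γ G s =
  ∀ i → i ≤ s → (p q : Vec (Fin n) (suc i)) → IsGeodesic Γ p → IsGeodesic Γ q →
    Σ (Permutation′ n) λ g → G g × map (g ⟨$⟩ʳ_) p ≡ q

Nontrivial : ∀ {n} → (Permutation′ n → Set) → Set
Nontrivial {n} N = Σ (Permutation′ n) λ x → N x × Σ (Fin n) λ u → x ⟨$⟩ʳ u ≢ u

SameOrbit : ∀ {n} → (Permutation′ n → Set) → Fin n → Fin n → Set
SameOrbit {n} N u v = Σ (Permutation′ n) λ x → N x × x ⟨$⟩ʳ u ≡ v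

Intransitive : ∀ {n} → (Permutation′ n → Set) → Set
Intransitive {n} N = Σ (Fin n) λ u → Σ (Fin n) λ v → ¬ SameOrbit N u v

module Submission where

open import Defs
open import Data.Nat using (ℕ; suc; _≤_; _<_; z≤n; s≤s)
open import Data.Fin using (Fin)
open import Data.Fin.Permutation using (Permutation′; _⟨$⟩ʳ_; _⟨$⟩ˡ_; flip; _∘ₚ_; id; inverseˡ)
open import Data.Vec using (Vec; []; _∷_; head; last)
open import Data.Vec.Properties using (∷-injective)
open import Data.Product using (Σ; _×_; _,_)
open import Data.Sum using (_⊎_; inj₁; inj₂)
open import Data.Unit using (tt)
open import Relation.Nullary using (¬_)
open import Relation.Binary.Structures using (IsEquivalence)
open import Relation.Binary.PropositionalEquality
  using (_≡_; refl; sym; trans; cong; module ≡-Reasoning)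
open import Relation.Binary.Construct.Closure.ReflexiveTransitive using (fold)

-- A normal subgroup N of an arc-transitive group has either all arcs or no arc inside
-- its orbits. If one arc lies in an N-orbit, then so does every arc, so the
-- N-orbits are unions of connected components of the underlying graph; in a
-- connected digraph this makes N transitive.

module _ {n : ℕ} {N : Permutation′ n → Set} (N-subgroup : IsSubgroup N) where
  open IsSubgroup N-subgroup

  sameOrbit-isEquivalence : IsEquivalence (SameOrbit N)
  sameOrbit-isEquivalence = record
    { refl  = id , id-mem , refl
    ; sym   = λ { (x , Nx , xu≡v) →
                flip x , inv-mem Nx , trans (cong (x ⟨$⟩ˡ_) (sym xu≡v)) (inverseˡ x) }
    ; trans = λ { (x , Nx , xu≡v) (y , Ny , yv≡w) →
                x ∘ₚ y , ∘-mem Nx Ny , trans (cong (y ⟨$⟩ʳ_) xu≡v) yv≡w }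
    }

module _ {n : ℕ} {N G : Permutation′ n → Set} (N⊴G : IsNormalSubgroupOf N G) where
  open IsNormalSubgroupOf N⊴G

  sameOrbit-image : ∀ {g u v} → G g → SameOrbit N u v →
                    SameOrbit N (g ⟨$⟩ʳ u) (g ⟨$⟩ʳ v)
  sameOrbit-image {g} {u} {v} Gg (x , Nx , xu≡v) = (flip g ∘ₚ x) ∘ₚ g , conj Gg Nx , gxg⁻¹
    where
    open ≡-Reasoning
    gxg⁻¹ : g ⟨$⟩ʳ (x ⟨$⟩ʳ (g ⟨$⟩ˡ (g ⟨$⟩ʳ u))) ≡ g ⟨$⟩ʳ v
    gxg⁻¹ = begin
      g ⟨$⟩ʳ (x ⟨$⟩ʳ (g ⟨$⟩ˡ (g ⟨$⟩ʳ u))) ≡⟨ cong (λ w → g ⟨$⟩ʳ (x ⟨$⟩ʳ w)) (inverseˡ g) ⟩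
      g ⟨$⟩ʳ (x ⟨$⟩ʳ u)                   ≡⟨ cong (g ⟨$⟩ʳ_) xu≡v ⟩
      g ⟨$⟩ʳ v                            ∎

module _ {n : ℕ} (Γ : Digraph n) where

  Adjacent : Fin n → Fin n → Set
  Adjacent u v = _⇒_ Γ u v ⊎ _⇒_ Γ v u

  ArcTransitive : (Permutation′ n → Set) → Set
  ArcTransitive G = ∀ {u v a b} → _⇒_ Γ u v → _⇒_ Γ a b →
    Σ (Permutation′ n) λ g → G g × g ⟨$⟩ʳ u ≡ a × g ⟨$⟩ʳ v ≡ b

  arc-isGeodesic : ∀ {u v} → _⇒_ Γ u v → IsGeodesic Γ (u ∷ v ∷ [])
  arc-isGeodesic {u} {v} u⇒v =
    (u⇒v , tt) , ((u ∷ v ∷ [] , (u⇒v , tt) , refl , refl) , no-0-arc)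
    where
    no-0-arc : ∀ j → j < 1 → ¬ (Σ (Vec (Fin n) (suc j)) λ p →
                                  IsArcSeq Γ p × head p ≡ u × last p ≡ v)
    no-0-arc .0 (s≤s z≤n) (w ∷ [] , _ , refl , refl) = irrefl Γ u⇒v

  geodesicTransitive⇒arcTransitive : ∀ {G s} → 1 ≤ s → GeodesicTransitive Γ G s →
                                     ArcTransitive G
  geodesicTransitive⇒arcTransitive 1≤s gt u⇒v a⇒b
    with gt 1 1≤s _ _ (arc-isGeodesic u⇒v) (arc-isGeodesic a⇒b)
  ... | g , Gg , gp≡q with ∷-injective gp≡q
  ... | gu≡a , rest with ∷-injective rest
  ... | gv≡b , _ = g , Gg , gu≡a , gv≡b

  module _ {N : Permutation′ n → Set} (N-subgroup : IsSubgroup N) where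
    open IsEquivalence (sameOrbit-isEquivalence N-subgroup)
      renaming (refl to orbit-refl; sym to orbit-sym; trans to orbit-trans)

    connected⇒transitive : Connected Γ → (∀ {u v} → _⇒_ Γ u v → SameOrbit N u v) →
                           ∀ u v → SameOrbit N u v
    connected⇒transitive conn arc-inside u v = fold (SameOrbit N) step orbit-refl (conn u v)
      where
      step : ∀ {a b c} → Adjacent a b → SameOrbit N b c → SameOrbit N a c
      step (inj₁ a⇒b) = orbit-trans (arc-inside a⇒b)
      step (inj₂ b⇒a) = orbit-trans (orbit-sym (arc-inside b⇒a))

  arc-inside-orbit⇒all-arcs : ∀ {G N} → IsNormalSubgroupOf N G → ArcTransitive G →
    ∀ {u v} → _⇒_ Γ u v → SameOrbit N u v →
    ∀ {a b} → _⇒_ Γ a b → SameOrbit N a b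
  arc-inside-orbit⇒all-arcs N⊴G arcTrans u⇒v uNv a⇒b with arcTrans u⇒v a⇒b
  ... | g , Gg , refl , refl = sameOrbit-image N⊴G Gg uNv

lemma3p1 : ∀ {n : ℕ} (Γ : Digraph n) (G N : Permutation′ n → Set) (s : ℕ) →
    1 ≤ s → Connected Γ →
    IsSubgroup G → (∀ {g} → G g → IsAut Γ g) →
    GeodesicTransitive Γ G s →
    IsNormalSubgroupOf N G → Nontrivial N → Intransitive N →
    ¬ (Σ (Fin n) λ u → Σ (Fin n) λ v → _⇒_ Γ u v × SameOrbit N u v)
lemma3p1 Γ G N s 1≤s conn _ _ gt N⊴G _ (a , b , a≁b) (u , v , u⇒v , uNv) =
  a≁b (connected⇒transitive Γ (IsNormalSubgroupOf.subgroup N⊴G) conn all-arcs-inside a b)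
  where
  all-arcs-inside : ∀ {x y} → _⇒_ Γ x y → SameOrbit N x y
  all-arcs-inside = arc-inside-orbit⇒all-arcs Γ N⊴G
    (geodesicTransitive⇒arcTransitive Γ 1≤s gt) u⇒v uNv
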